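{- Let $H$ be a triangle-free cylindrical grid on $n$ vertices. Then $H$ contains an induced 2-degenerate subgraph on at least $\frac{7}{8}n$ vertices.
   Context: A cylindrical grid is the Cartesian product of a path and a cycle. A graph is 2-degenerate if every nonempty subgraph has a vertex of degree at most 2. -}

module Defs where

open import Data.Nat using (ℕ; suc; _≡ᵇ_; _≤_; _*_)
open import Data.Bool using (Bool; true; false; _∧_; _∨_)
open import Data.Fin using (Fin; toℕ)
open import Data.List using (List; length; filterᵇ; allFin; cartesianProduct)
open import Data.List.Membership.Propositional using (_∈_)
open import Data.List.Relation.Unary.Unique.Propositional using (Unique)
open import Data.List.Membership.Propositional.Properties using (∈-allFin; ∈-cartesianProduct⁺)
open import Data.List.Relation.Unary.Unique.Propositional.Properties using (allFin⁺; cartesianProduct⁺)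
open import Data.Product using (Σ; _×_; _,_; ∃)
open import Relation.Binary.PropositionalEquality using (_≡_)
open import Relation.Nullary using (¬_)

record FinGraph : Set₁ where
  field
    V        : Set
    vertices : List V
    complete : ∀ v → v ∈ vertices
    unique   : Unique vertices
    adj      : V → V → Bool

open FinGraph public

card : (G : FinGraph) → (V G → Bool) → ℕ
card G S = length (filterᵇ S (vertices G))

degIn : (G : FinGraph) → (V G → Bool) → V G → ℕ
degIn G T v = length (filterᵇ (λ u → T u ∧ adj G v u) (vertices G))

InducedTwoDegenerate : (G : FinGraph) → (V G → Bool) → Set
InducedTwoDegenerate G S =
  (T : V G → Bool) →
  (∀ v → T v ≡ true → S v ≡ true) →
  (∃ λ v → T v ≡ true) →
  ∃ λ v → (T v ≡ true) × (degIn G T v ≤ 2)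

TriangleFree : FinGraph → Set
TriangleFree G = ¬ (Σ (V G) λ a → Σ (V G) λ b → Σ (V G) λ c →
  (adj G a b ≡ true) × (adj G b c ≡ true) × (adj G a c ≡ true))

pathAdj : {m : ℕ} → Fin m → Fin m → Bool
pathAdj a b = (suc (toℕ a) ≡ᵇ toℕ b) ∨ (suc (toℕ b) ≡ᵇ toℕ a)

cycSucc : {k : ℕ} → Fin k → Fin k → Bool
cycSucc {k} a b = (suc (toℕ a) ≡ᵇ toℕ b) ∨ ((suc (toℕ a) ≡ᵇ k) ∧ (toℕ b ≡ᵇ 0))

cycAdj : {k : ℕ} → Fin k → Fin k → Bool
cycAdj a b = cycSucc a b ∨ cycSucc b a

finEq : {n : ℕ} → Fin n → Fin n → Bool
finEq a b = toℕ a ≡ᵇ toℕ b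

gridAdj : (m k : ℕ) → Fin m × Fin k → Fin m × Fin k → Bool
gridAdj m k (i , j) (i' , j') =
  (finEq i i' ∧ cycAdj j j') ∨ (finEq j j' ∧ pathAdj i i')


cylGrid : (m k : ℕ) → FinGraph
cylGrid m k = record
  { V        = Fin m × Fin k
  ; vertices = cartesianProduct (allFin m) (allFin k)
  ; complete = λ { (i , j) → ∈-cartesianProduct⁺ (∈-allFin i) (∈-allFin j) }
  ; unique   = cartesianProduct⁺ (allFin⁺ m) (allFin⁺ k)
  ; adj      = gridAdj m k
  }

-- Delete from every odd row of P_m □ C_k its vertex in column 0. Listing the vertices row
-- by row, the first vertex of any set of kept vertices has at most two later kept
-- neighbours: the ones to its right and below it, or, in column 0, the one to its right and
-- the one closing its row cycle, since (a , 0) and (a + 1 , 0) are never both kept. At most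
-- m / 2 ≤ m k / 8 vertices are deleted because k ≥ 4, as C₃ would be a triangle.
module Submission where

open import Defs
open import Data.Nat using (ℕ; zero; suc; pred; _+_; _*_; _≤_; _≡ᵇ_; z≤n; s≤s)
open import Data.Nat.Properties
  using (≤-totalOrder; ≤-trans; ≡ᵇ⇒≡; n≤0⇒n≡0; 1+n≰n; <⇒≢; <⇒≱; m<n+m; +-suc; *-suc; *-identityʳ; *-assoc; *-comm;
         +-monoʳ-≤; +-monoˡ-<; *-monoʳ-≤; *-monoˡ-≤; +-cancelˡ-≤; +-cancelʳ-≤; module ≤-Reasoning)
open import Data.Bool using (Bool; true; false; not; _∧_; _∨_; T; T?)
open import Data.Bool.Properties using (T-≡; T-∧; T-∨)
open import Data.Fin using (Fin; toℕ) renaming (zero to fzero; suc to fsuc)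
open import Data.Fin.Properties using (toℕ-injective)
open import Data.List using (List; []; _∷_; _++_; length; map; filterᵇ; tabulate; allFin; cartesianProduct)
open import Data.List.Properties using (length-map; length-++; length-tabulate; filter-++; filter-none)
open import Data.List.Membership.Propositional using (_∈_)
open import Data.List.Membership.Propositional.Properties using (∈-filter⁺; ∈-filter⁻)
open import Data.List.Relation.Unary.All as All using (All; []; _∷_)
open import Data.List.Relation.Unary.All.Properties using (all-filter; tabulate⁺) renaming (map⁺ to All-map⁺)
open import Data.List.Relation.Unary.AllPairs using ([]; _∷_)
open import Data.List.Relation.Unary.Unique.Propositional using (Unique)
import Data.List.Relation.Unary.Unique.Propositional.Properties as Unique
open import Data.List.Extrema ≤-totalOrder using (argmin; argmin-all; f[argmin]≤f[xs])
open import Data.Product using (Σ; _×_; _,_; ∃; proj₁; proj₂)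
open import Data.Sum using (_⊎_; inj₁; inj₂; [_,_]′) renaming (map to map-⊎)
open import Data.Empty using (⊥; ⊥-elim)
open import Function using (_∘_; id; Equivalence)
open import Relation.Binary.PropositionalEquality
open import Relation.Nullary using (¬_)
open import Data.Nat.Tactic.RingSolver using (solve-∀)

private
  from-T : ∀ {b} → T b → b ≡ true
  from-T = Equivalence.to T-≡

  to-T : ∀ {b} → b ≡ true → T b
  to-T = Equivalence.from T-≡

  ∧-true : ∀ {b c} → b ∧ c ≡ true → b ≡ true × c ≡ true
  ∧-true {true} c≡true = refl , c≡true

length-filterᵇ-not : {A : Set} (p : A → Bool) (xs : List A) →
  length (filterᵇ (not ∘ p) xs) + length (filterᵇ p xs) ≡ length xs
length-filterᵇ-not p [] = refl
length-filterᵇ-not p (x ∷ xs) with p x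
... | true  = trans (+-suc _ _) (cong suc (length-filterᵇ-not p xs))
... | false = cong suc (length-filterᵇ-not p xs)

length-filterᵇ-map : {A B : Set} (p : B → Bool) (f : A → B) (xs : List A) →
  length (filterᵇ p (map f xs)) ≡ length (filterᵇ (p ∘ f) xs)
length-filterᵇ-map p f [] = refl
length-filterᵇ-map p f (x ∷ xs) with p (f x)
... | true  = cong suc (length-filterᵇ-map p f xs)
... | false = length-filterᵇ-map p f xs

unique-all-≡⇒length≤1 : {A : Set} {xs : List A} {r : A} → Unique xs → All (_≡ r) xs → length xs ≤ 1
unique-all-≡⇒length≤1 {xs = []} _ _ = z≤n
unique-all-≡⇒length≤1 {xs = _ ∷ []} _ _ = s≤s z≤n
unique-all-≡⇒length≤1 {xs = _ ∷ _ ∷ _} ((x≢y ∷ _) ∷ _) (refl ∷ refl ∷ _) = ⊥-elim (x≢y refl)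

unique-all-∈pair⇒length≤2 : {A : Set} {xs : List A} {p q : A} → Unique xs →
  All (λ x → x ≡ p ⊎ x ≡ q) xs → length xs ≤ 2
unique-all-∈pair⇒length≤2 {xs = []} _ _ = z≤n
unique-all-∈pair⇒length≤2 {xs = x ∷ xs} (x∉xs ∷ xs!) (inj₁ refl ∷ xs⊆pq) =
  s≤s (unique-all-≡⇒length≤1 xs!
    (All.zipWith (λ (x≢y , y∈pq) → [ ⊥-elim ∘ x≢y ∘ sym , id ]′ y∈pq) (x∉xs , xs⊆pq)))
unique-all-∈pair⇒length≤2 {xs = x ∷ xs} (x∉xs ∷ xs!) (inj₂ refl ∷ xs⊆pq) =
  s≤s (unique-all-≡⇒length≤1 xs!
    (All.zipWith (λ (x≢y , y∈pq) → [ id , ⊥-elim ∘ x≢y ∘ sym ]′ y∈pq) (x∉xs , xs⊆pq)))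

length-filterᵇ≤2 : {A K : Set} (key : A → K) → (∀ {x y} → key x ≡ key y → x ≡ y) →
  (P : A → Bool) (xs : List A) (p q : K) → Unique xs →
  (∀ x → x ∈ xs → P x ≡ true → key x ≡ p ⊎ key x ≡ q) →
  length (filterᵇ P xs) ≤ 2
length-filterᵇ≤2 key key-inj P xs p q xs! keys⊆pq = begin
  length (filterᵇ P xs)             ≡⟨ length-map key (filterᵇ P xs) ⟨
  length (map key (filterᵇ P xs))   ≤⟨ unique-all-∈pair⇒length≤2 keys! keys⊆ ⟩
  2                                 ∎
  where
  open ≤-Reasoning
  keys! : Unique (map key (filterᵇ P xs))
  keys! = Unique.map⁺ key-inj (Unique.filter⁺ (T? ∘ P) xs!)
  keys⊆ : All (λ y → y ≡ p ⊎ y ≡ q) (map key (filterᵇ P xs))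
  keys⊆ = All-map⁺ (All.tabulate λ x∈ →
    let (x∈xs , Px) = ∈-filter⁻ (T? ∘ P) {xs = xs} x∈ in keys⊆pq _ x∈xs (from-T Px))

length-cartesianProduct : {A B : Set} (xs : List A) (ys : List B) →
  length (cartesianProduct xs ys) ≡ length xs * length ys
length-cartesianProduct [] ys = refl
length-cartesianProduct (x ∷ xs) ys = begin
  length (map (x ,_) ys ++ cartesianProduct xs ys)
    ≡⟨ length-++ (map (x ,_) ys) ⟩
  length (map (x ,_) ys) + length (cartesianProduct xs ys)
    ≡⟨ cong₂ _+_ (length-map (x ,_) ys) (length-cartesianProduct xs ys) ⟩
  length ys + length xs * length ys ∎
  where open ≡-Reasoning

length-filterᵇ-cartesianProduct : {A B : Set} (p : A → Bool) (q : B → Bool) (xs : List A) (ys : List B) →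
  length (filterᵇ (λ (x , y) → p x ∧ q y) (cartesianProduct xs ys)) ≡
  length (filterᵇ p xs) * length (filterᵇ q ys)
length-filterᵇ-cartesianProduct p q [] ys = refl
length-filterᵇ-cartesianProduct {A} {B} p q (x ∷ xs) ys = begin
  length (filterᵇ r (map (x ,_) ys ++ cartesianProduct xs ys))
    ≡⟨ cong length (filter-++ (T? ∘ r) (map (x ,_) ys) _) ⟩
  length (filterᵇ r (map (x ,_) ys) ++ filterᵇ r (cartesianProduct xs ys))
    ≡⟨ length-++ (filterᵇ r (map (x ,_) ys)) ⟩
  length (filterᵇ r (map (x ,_) ys)) + length (filterᵇ r (cartesianProduct xs ys))
    ≡⟨ cong₂ _+_ (length-filterᵇ-map r (x ,_) ys) (length-filterᵇ-cartesianProduct p q xs ys) ⟩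
  length (filterᵇ (λ y → p x ∧ q y) ys) + length (filterᵇ p xs) * length (filterᵇ q ys)
    ≡⟨ first-row ⟩
  length (filterᵇ p (x ∷ xs)) * length (filterᵇ q ys) ∎
  where
  open ≡-Reasoning
  r : A × B → Bool
  r (x , y) = p x ∧ q y
  first-row : length (filterᵇ (λ y → p x ∧ q y) ys) + length (filterᵇ p xs) * length (filterᵇ q ys) ≡
              length (filterᵇ p (x ∷ xs)) * length (filterᵇ q ys)
  first-row with p x
  ... | true  = refl
  ... | false = cong (λ l → length l + length (filterᵇ p xs) * length (filterᵇ q ys))
                     (filter-none (T? ∘ λ _ → false) (All.universal (λ _ ()) ys))

∃-rank-minimal : {A : Set} (rank : A → ℕ) (P : A → Bool) (xs : List A) {v : A} → P v ≡ true →
  ∃ λ w → P w ≡ true × (∀ u → u ∈ xs → P u ≡ true → rank w ≤ rank u)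
∃-rank-minimal rank P xs {v} Pv =
  argmin rank v (filterᵇ P xs) ,
  argmin-all rank Pv (All.map from-T (all-filter (T? ∘ P) xs)) ,
  λ u u∈xs Pu → All.lookup (f[argmin]≤f[xs] v (filterᵇ P xs)) (∈-filter⁺ (T? ∘ P) u∈xs (to-T Pu))

twoDegenerate-byRank : (G : FinGraph) (S : V G → Bool) {K : Set} (key : V G → K) →
  (∀ {x y} → key x ≡ key y → x ≡ y) → (rank : V G → ℕ) (next₁ next₂ : V G → K) →
  (∀ {v u} → S v ≡ true → S u ≡ true → adj G v u ≡ true → rank v ≤ rank u →
     key u ≡ next₁ v ⊎ key u ≡ next₂ v) →
  InducedTwoDegenerate G S
twoDegenerate-byRank G S key key-inj rank next₁ next₂ later T T⊆S (v , Tv) =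
  let (w , Tw , w-min) = ∃-rank-minimal rank T (vertices G) Tv in
  w , Tw ,
  length-filterᵇ≤2 key key-inj (λ u → T u ∧ adj G w u) (vertices G) (next₁ w) (next₂ w) (unique G)
    λ u _ Tu∧wu → let (Tu , wu) = ∧-true Tu∧wu in
      later (T⊆S w Tw) (T⊆S u Tu) wu (w-min u (complete G u) Tu)

data Step (k : ℕ) : ℕ × ℕ → ℕ × ℕ → Set where
  down  : ∀ {a b} → Step k (a , b) (suc a , b)
  right : ∀ {a b} → Step k (a , b) (a , suc b)
  wrap  : ∀ {a b} → suc b ≡ k → Step k (a , b) (a , 0)

gridKey : {m k : ℕ} → Fin m × Fin k → ℕ × ℕ
gridKey (i , j) = toℕ i , toℕ j

gridKey-injective : {m k : ℕ} {v u : Fin m × Fin k} → gridKey v ≡ gridKey u → v ≡ u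
gridKey-injective {v = _ , _} {u = _ , _} e =
  cong₂ _,_ (toℕ-injective (cong proj₁ e)) (toℕ-injective (cong proj₂ e))

pathSucc⇒Step : ∀ {k} a a' b → T (suc a ≡ᵇ a') → Step k (a , b) (a' , b)
pathSucc⇒Step a a' b t with refl ← ≡ᵇ⇒≡ (suc a) a' t = down

cycSucc⇒Step : ∀ {k} a b b' → T ((suc b ≡ᵇ b') ∨ ((suc b ≡ᵇ k) ∧ (b' ≡ᵇ 0))) → Step k (a , b) (a , b')
cycSucc⇒Step {k} a b b' t with Equivalence.to T-∨ t
... | inj₁ t′ with refl ← ≡ᵇ⇒≡ (suc b) b' t′ = right
... | inj₂ t′ with Equivalence.to T-∧ t′
...   | sb≡k , b'≡0 with refl ← ≡ᵇ⇒≡ b' 0 b'≡0 = wrap (≡ᵇ⇒≡ (suc b) k sb≡k)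

gridAdj⇒Step : ∀ {m k} (v u : Fin m × Fin k) → T (gridAdj m k v u) →
  Step k (gridKey v) (gridKey u) ⊎ Step k (gridKey u) (gridKey v)
gridAdj⇒Step (i , j) (i' , j') t with Equivalence.to T-∨ t
... | inj₁ t₁ with Equivalence.to T-∧ t₁
...   | i≡i' , c rewrite ≡ᵇ⇒≡ (toℕ i) (toℕ i') i≡i' =
  map-⊎ (cycSucc⇒Step (toℕ i') _ _) (cycSucc⇒Step (toℕ i') _ _) (Equivalence.to T-∨ c)
gridAdj⇒Step (i , j) (i' , j') t | inj₂ t₂ with Equivalence.to T-∧ t₂
...   | j≡j' , c rewrite ≡ᵇ⇒≡ (toℕ j) (toℕ j') j≡j' =
  map-⊎ (pathSucc⇒Step _ _ (toℕ j')) (pathSucc⇒Step _ _ (toℕ j')) (Equivalence.to T-∨ c)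

odd : ℕ → Bool
odd zero          = false
odd (suc zero)    = true
odd (suc (suc n)) = odd n

hole : ℕ × ℕ → Bool
hole (a , b) = odd a ∧ (b ≡ᵇ 0)

rowMajor : ℕ → ℕ × ℕ → ℕ
rowMajor k (a , b) = a * k + b

-- Candidates are keys rather than vertices: next₁ may point past the last row.
next₁ : ℕ × ℕ → ℕ × ℕ
next₁ (a , zero)  = a , 1
next₁ (a , suc b) = suc a , suc b

next₂ : ℕ → ℕ × ℕ → ℕ × ℕ
next₂ k (a , zero)  = a , pred k
next₂ k (a , suc b) = a , suc (suc b)

column₀-not-both-kept : ∀ a → not (hole (a , 0)) ≡ true → not (hole (suc a , 0)) ≡ true → ⊥
column₀-not-both-kept zero          _ ()
column₀-not-both-kept (suc zero)    ()
column₀-not-both-kept (suc (suc a)) = column₀-not-both-kept a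

later-kept-neighbour : ∀ {k} → 2 ≤ k → ∀ {v u} → not (hole v) ≡ true → not (hole u) ≡ true →
  Step k v u ⊎ Step k u v → rowMajor k v ≤ rowMajor k u → u ≡ next₁ v ⊎ u ≡ next₂ k v
later-kept-neighbour _ kv ku (inj₁ (down {a} {zero})) _ = ⊥-elim (column₀-not-both-kept a kv ku)
later-kept-neighbour _ _  _  (inj₁ (down {b = suc _})) _ = inj₁ refl
later-kept-neighbour _ _  _  (inj₁ (right {b = zero})) _ = inj₁ refl
later-kept-neighbour _ _  _  (inj₁ (right {b = suc _})) _ = inj₂ refl
later-kept-neighbour {k} 2≤k _ _ (inj₁ (wrap {a} {b} sb≡k)) le
  with refl ← n≤0⇒n≡0 (+-cancelˡ-≤ (a * k) b 0 le) = ⊥-elim (<⇒≢ 2≤k sb≡k)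
later-kept-neighbour {k} 2≤k _ _ (inj₂ (down {a} {b})) le =
  ⊥-elim (<⇒≱ (+-monoˡ-< b (m<n+m (a * k) (≤-trans (s≤s z≤n) 2≤k))) le)
later-kept-neighbour {k} _ _ _ (inj₂ (right {a} {b})) le =
  ⊥-elim (1+n≰n (+-cancelˡ-≤ (a * k) (suc b) b le))
later-kept-neighbour _ _ _ (inj₂ (wrap {a} sb≡k)) _ = inj₂ (cong (λ n → a , pred n) sb≡k)

kept : {m k : ℕ} → Fin m × Fin k → Bool
kept = not ∘ hole ∘ gridKey

cylGrid-kept-twoDegenerate : ∀ m k → 2 ≤ k → InducedTwoDegenerate (cylGrid m k) kept
cylGrid-kept-twoDegenerate m k 2≤k =
  twoDegenerate-byRank (cylGrid m k) kept gridKey gridKey-injective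
    (rowMajor k ∘ gridKey) (next₁ ∘ gridKey) (next₂ k ∘ gridKey)
    λ {v} {u} kv ku vu → later-kept-neighbour 2≤k kv ku (gridAdj⇒Step v u (to-T vu))

double-count-odd≤ : {A : Set} (m : ℕ) (f : Fin m → A) (p : A → Bool) →
  (∀ i → p (f i) ≡ odd (toℕ i)) → 2 * length (filterᵇ p (tabulate f)) ≤ m
double-count-odd≤ zero f p p≡odd = z≤n
double-count-odd≤ (suc zero) f p p≡odd rewrite p≡odd fzero = z≤n
double-count-odd≤ (suc (suc m)) f p p≡odd rewrite p≡odd fzero | p≡odd (fsuc fzero) =
  begin
    2 * suc (length (filterᵇ p (tabulate (f ∘ fsuc ∘ fsuc))))
      ≡⟨ *-suc 2 _ ⟩
    2 + 2 * length (filterᵇ p (tabulate (f ∘ fsuc ∘ fsuc)))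
      ≤⟨ +-monoʳ-≤ 2 (double-count-odd≤ m (f ∘ fsuc ∘ fsuc) p (p≡odd ∘ fsuc ∘ fsuc)) ⟩
    2 + m ∎
  where open ≤-Reasoning

count-toℕ≡0 : (k : ℕ) → length (filterᵇ (λ j → toℕ j ≡ᵇ 0) (allFin (suc k))) ≡ 1
count-toℕ≡0 k =
  cong (suc ∘ length) (filter-none (T? ∘ λ j → toℕ j ≡ᵇ 0) (tabulate⁺ {n = k} {f = fsuc} λ _ ()))

card-holes : ∀ m k → card (cylGrid m (suc k)) (hole ∘ gridKey) ≡ length (filterᵇ (odd ∘ toℕ) (allFin m))
card-holes m k = begin
  card (cylGrid m (suc k)) (hole ∘ gridKey)
    ≡⟨ length-filterᵇ-cartesianProduct (odd ∘ toℕ) (λ j → toℕ j ≡ᵇ 0) (allFin m) (allFin (suc k)) ⟩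
  length (filterᵇ (odd ∘ toℕ) (allFin m)) * length (filterᵇ (λ j → toℕ j ≡ᵇ 0) (allFin (suc k)))
    ≡⟨ cong (length (filterᵇ (odd ∘ toℕ) (allFin m)) *_) (count-toℕ≡0 k) ⟩
  length (filterᵇ (odd ∘ toℕ) (allFin m)) * 1
    ≡⟨ *-identityʳ _ ⟩
  length (filterᵇ (odd ∘ toℕ) (allFin m)) ∎
  where open ≡-Reasoning

card-kept+card-holes : ∀ m k → card (cylGrid m k) kept + card (cylGrid m k) (hole ∘ gridKey) ≡ m * k
card-kept+card-holes m k = begin
  card (cylGrid m k) kept + card (cylGrid m k) (hole ∘ gridKey)
    ≡⟨ length-filterᵇ-not (hole ∘ gridKey) (vertices (cylGrid m k)) ⟩
  length (cartesianProduct (allFin m) (allFin k))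
    ≡⟨ length-cartesianProduct (allFin m) (allFin k) ⟩
  length (allFin m) * length (allFin k)
    ≡⟨ cong₂ _*_ (length-tabulate {n = m} id) (length-tabulate {n = k} id) ⟩
  m * k ∎
  where open ≡-Reasoning

seven-eighths : ∀ {s r n} → s + r ≡ n → 8 * r ≤ n → 7 * n ≤ 8 * s
seven-eighths {s} {r} {n} refl 8r≤n = +-cancelʳ-≤ (8 * r) (7 * n) (8 * s) (begin
  7 * n + 8 * r ≤⟨ +-monoʳ-≤ (7 * n) 8r≤n ⟩
  7 * n + n     ≡⟨ eq s r ⟩
  8 * s + 8 * r ∎)
  where
  open ≤-Reasoning
  eq : ∀ s r → 7 * (s + r) + (s + r) ≡ 8 * s + 8 * r
  eq = solve-∀

cylGrid-kept-large : ∀ m k → 4 ≤ k → 7 * (m * k) ≤ 8 * card (cylGrid m k) kept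
cylGrid-kept-large m (suc k) 4≤k =
  seven-eighths {card (cylGrid m (suc k)) kept} {card (cylGrid m (suc k)) (hole ∘ gridKey)}
    (card-kept+card-holes m (suc k)) (begin
  8 * card (cylGrid m (suc k)) (hole ∘ gridKey) ≡⟨ cong (8 *_) (card-holes m k) ⟩
  8 * h                                         ≡⟨ *-assoc 4 2 h ⟩
  4 * (2 * h)                                   ≤⟨ *-monoʳ-≤ 4 (double-count-odd≤ m id (odd ∘ toℕ) (λ _ → refl)) ⟩
  4 * m                                         ≤⟨ *-monoˡ-≤ m 4≤k ⟩
  suc k * m                                     ≡⟨ *-comm (suc k) m ⟩
  m * suc k                                     ∎)
  where
  open ≤-Reasoning
  h : ℕ
  h = length (filterᵇ (odd ∘ toℕ) (allFin m))

C₃-triangle : ∀ m → ¬ TriangleFree (cylGrid (suc m) 3)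
C₃-triangle m triangle-free =
  triangle-free ((fzero , fzero) , (fzero , fsuc fzero) , (fzero , fsuc (fsuc fzero)) , refl , refl , refl)

lemma3p4 : (m k : ℕ) → 1 ≤ m → 3 ≤ k → TriangleFree (cylGrid m k) →
    Σ (V (cylGrid m k) → Bool) λ S →
      InducedTwoDegenerate (cylGrid m k) S × (7 * (m * k) ≤ 8 * card (cylGrid m k) S)
lemma3p4 _ 0 _ () _
lemma3p4 _ 1 _ (s≤s ()) _
lemma3p4 _ 2 _ (s≤s (s≤s ())) _
lemma3p4 0 3 () _ _
lemma3p4 (suc m) 3 _ _ triangle-free = ⊥-elim (C₃-triangle m triangle-free)
lemma3p4 m k@(suc (suc (suc (suc _)))) _ _ _ =
  kept ,
  cylGrid-kept-twoDegenerate m k (s≤s (s≤s z≤n)) ,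
  cylGrid-kept-large m k (s≤s (s≤s (s≤s (s≤s z≤n))))
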